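{- Let $k\ge1$ and $n\ge1$. The family $\mathrm{SEQ}(\mathcal{B})_n(k)$ of sequences of $k$-bundled increasing trees of total order $n$ is in bijection with the family $\mathcal{A}_n(k+2)$ of $(k+2)$-ary increasing trees of order $n$.
   Context: A $k$-bundled increasing tree is a rooted tree with vertex labels increasing along every path away from the root, in which every vertex has $k$ ordered bundles, each containing a (possibly empty) linearly ordered sequence of children; each non-root vertex lies in exactly one bundle of its parent. $\mathrm{SEQ}(\mathcal{B})_n(k)$ is the set of finite (ordered, possibly of any length) sequences $(t_1,\dots,t_r)$ of $k$-bundled increasing trees whose label sets are pairwise disjoint and together form a partition of $\{1,\dots,n\}$ (each $t_i$ being increasing with respect to its own labels). A $(k+2)$-ary increasing tree of order $n$ is a rooted tree on $\{1,\dots,n\}$ with root $1$ and labels increasing along paths away from the root, in which every vertex has $k+2$ positions numbered $1,\dots,k+2$, each empty or occupied by exactly one child, every non-root vertex occupying exactly one position of its parent. -}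

module Defs where

open import Data.Nat using (ℕ; zero; suc; _+_; _<ᵇ_; _≡ᵇ_)
open import Data.Bool using (Bool; true; false; _∧_; if_then_else_)
open import Data.List using (List; []; _∷_; _++_; length)
open import Data.Vec using (Vec; []; _∷_)
open import Data.Maybe using (Maybe; just; nothing)
open import Data.Product using (Σ)
open import Relation.Binary.PropositionalEquality using (_≡_)

count : ℕ → List ℕ → ℕ
count i [] = 0
count i (x ∷ xs) = if i ≡ᵇ x then suc (count i xs) else count i xs

allOnce : ℕ → List ℕ → Bool
allOnce zero L = true
allOnce (suc m) L = (count (suc m) L ≡ᵇ 1) ∧ allOnce m L

isPartition : ℕ → List ℕ → Bool
isPartition n L = (length L ≡ᵇ n) ∧ allOnce n L

-- k-bundled (labelled, not yet increasing-checked) trees: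
-- a vertex label and k ordered bundles, each an ordered list of children.

data BTree (k : ℕ) : Set where
  node : ℕ → Vec (List (BTree k)) k → BTree k

rootB : ∀ {k} → BTree k → ℕ
rootB (node x _) = x

mutual
  labelsB : ∀ {k} → BTree k → List ℕ
  labelsB (node x bs) = x ∷ labelsV bs

  labelsV : ∀ {k j} → Vec (List (BTree k)) j → List ℕ
  labelsV [] = []
  labelsV (l ∷ v) = labelsL l ++ labelsV v

  labelsL : ∀ {k} → List (BTree k) → List ℕ
  labelsL [] = []
  labelsL (t ∷ ts) = labelsB t ++ labelsL ts

mutual
  incrB : ∀ {k} → BTree k → Bool
  incrB (node x bs) = incrV x bs

  incrV : ∀ {k j} → ℕ → Vec (List (BTree k)) j → Bool
  incrV x [] = true
  incrV x (l ∷ v) = incrL x l ∧ incrV x v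

  incrL : ∀ {k} → ℕ → List (BTree k) → Bool
  incrL x [] = true
  incrL x (t ∷ ts) = (x <ᵇ rootB t) ∧ incrB t ∧ incrL x ts

allIncrB : ∀ {k} → List (BTree k) → Bool
allIncrB [] = true
allIncrB (t ∷ ts) = incrB t ∧ allIncrB ts

SEQB : ℕ → ℕ → Set
SEQB k n = Σ (List (BTree k)) λ ts → (allIncrB ts ∧ isPartition n (labelsL ts)) ≡ true

-- m-ary trees: every vertex has m positions, each empty or holding one child.

data ATree (m : ℕ) : Set where
  node : ℕ → Vec (Maybe (ATree m)) m → ATree m

rootA : ∀ {m} → ATree m → ℕ
rootA (node x _) = x

mutual
  labelsA : ∀ {m} → ATree m → List ℕ
  labelsA (node x cs) = x ∷ labelsAV cs

  labelsAV : ∀ {m j} → Vec (Maybe (ATree m)) j → List ℕ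
  labelsAV [] = []
  labelsAV (nothing ∷ v) = labelsAV v
  labelsAV (just t ∷ v) = labelsA t ++ labelsAV v

mutual
  incrA : ∀ {m} → ATree m → Bool
  incrA (node x cs) = incrAV x cs

  incrAV : ∀ {m j} → ℕ → Vec (Maybe (ATree m)) j → Bool
  incrAV x [] = true
  incrAV x (nothing ∷ v) = incrAV x v
  incrAV x (just t ∷ v) = (x <ᵇ rootA t) ∧ incrA t ∧ incrAV x v

A : ℕ → ℕ → Set
A m n = Σ (ATree m) λ t → (incrA t ∧ isPartition n (labelsA t)) ≡ true

module Submission where

-- Both families are counted by inserting the largest label.
-- If a structure carries the labels 1,…,n, the new label n+1 can only be
-- placed as a fresh leaf in one of its "gaps", and every structure on
-- 1,…,n+1 arises from exactly one structure on 1,…,n and one gap, because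
-- in an increasing structure the maximal label sits at a leaf.  For a
-- sequence of k-bundled trees a gap is a position in one of the ordered
-- child lists (or in the top-level sequence); for an m-ary tree it is an
-- empty position.  In both cases a structure with n labels has exactly
-- 1 + d·n gaps, where d = k + 1 = m − 1.

open import Defs
open import Data.Nat using (ℕ; zero; suc; _+_; _*_; _≤_; _<_; s≤s; _<ᵇ_; _≡ᵇ_)
open import Data.Nat.Properties
  using ( ≡ᵇ⇒≡; ≡⇒≡ᵇ; <ᵇ⇒<; <⇒<ᵇ; <⇒≢; <-irrefl; <-≤-trans; <-trans; n<1+n
        ; ≤-refl; m≤n⇒m≤1+n; +-comm; *-suc; *-zeroʳ )
open import Data.Nat.Tactic.RingSolver using (solve-∀)
open import Data.Bool using (Bool; true; false; _∧_)
open import Data.Bool.Properties using (T-≡) renaming (_≟_ to _≟ᵇ_)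
open import Data.Empty using (⊥; ⊥-elim)
open import Data.Unit using (⊤; tt)
open import Data.Sum using (_⊎_; inj₁; inj₂)
open import Data.Product using (Σ; ∃; _,_; proj₁; proj₂; _×_)
open import Data.Maybe using (Maybe; just; nothing)
open import Data.Maybe.Properties using (just-injective)
open import Data.Fin using (Fin)
open import Data.Fin.Properties using (+↔⊎; 0↔⊥; 1↔⊤)
open import Data.Vec using (Vec; []; _∷_; replicate)
import Data.Vec.Properties as Vec
open import Data.List using (List; []; _∷_; _++_; length; [_])
open import Data.List.Properties using (length-++; ∷-injectiveˡ; ∷-injectiveʳ)
open import Data.List.Relation.Unary.All as All using (All; []; _∷_)
open import Data.List.Relation.Unary.All.Properties using (++⁻ˡ; ++⁻ʳ; ++⁻)
open import Data.List.Relation.Unary.Any using (here; there)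
open import Data.List.Membership.Propositional using (_∈_)
open import Data.List.Membership.Propositional.Properties using (∈-∃++; ∈-++⁻)
open import Data.List.Relation.Binary.Permutation.Propositional using (_↭_; ↭-sym)
import Data.List.Relation.Binary.Permutation.Propositional as ↭
open import Data.List.Relation.Binary.Permutation.Propositional.Properties
  using (↭-length; All-resp-↭; ∈-resp-↭; shift; ++⁺ˡ; ++⁺ʳ)
open import Function using (_∘_)
open import Function.Bundles using (_↔_; _⤖_; mk↔ₛ′; Equivalence)
open import Function.Properties.Inverse using (↔-trans; ↔-sym; ↔-refl; ↔⇒⤖)
open import Data.Sum.Function.Propositional using (_⊎-↔_)
open import Data.Product.Function.NonDependent.Propositional using (_×-↔_)
open import Data.Product.Function.Dependent.Propositional using (Σ-↔)
open import Axiom.UniquenessOfIdentityProofs using (module Decidable⇒UIP)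
open import Relation.Binary.PropositionalEquality
  using (_≡_; _≢_; refl; sym; trans; cong; cong₂; subst; module ≡-Reasoning)

∧-elimˡ : ∀ {a b} → a ∧ b ≡ true → a ≡ true
∧-elimˡ {true} _ = refl

∧-elimʳ : ∀ {a b} → a ∧ b ≡ true → b ≡ true
∧-elimʳ {true} e = e

∧-intro : ∀ {a b} → a ≡ true → b ≡ true → a ∧ b ≡ true
∧-intro refl refl = refl

bool-ext : ∀ {a b} → (a ≡ true → b ≡ true) → (b ≡ true → a ≡ true) → a ≡ b
bool-ext {true}  f _ = sym (f refl)
bool-ext {false} {true}  _ g = g refl
bool-ext {false} {false} _ _ = refl

true-irrelevant : ∀ {b} (p q : b ≡ true) → p ≡ q
true-irrelevant = Decidable⇒UIP.≡-irrelevant _≟ᵇ_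

≡ᵇ-refl : ∀ n → (n ≡ᵇ n) ≡ true
≡ᵇ-refl n = Equivalence.to T-≡ (≡⇒≡ᵇ n n refl)

≡ᵇ-sound : ∀ {m n} → (m ≡ᵇ n) ≡ true → m ≡ n
≡ᵇ-sound {m} {n} e = ≡ᵇ⇒≡ m n (Equivalence.from T-≡ e)

≡ᵇ-≢ : ∀ {m n} → m ≢ n → (m ≡ᵇ n) ≡ false
≡ᵇ-≢ {m} {n} m≢n with m ≡ᵇ n in e
... | true  = ⊥-elim (m≢n (≡ᵇ-sound e))
... | false = refl

<ᵇ-complete : ∀ {m n} → m < n → (m <ᵇ n) ≡ true
<ᵇ-complete m<n = Equivalence.to T-≡ (<⇒<ᵇ m<n)

<ᵇ-sound : ∀ {m n} → (m <ᵇ n) ≡ true → m < n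
<ᵇ-sound {m} {n} e = <ᵇ⇒< m n (Equivalence.from T-≡ e)

-- Partitions of {1,…,n}.

count-↭ : ∀ i {xs ys} → xs ↭ ys → count i xs ≡ count i ys
count-↭ i ↭.refl = refl
count-↭ i (↭.prep x p) with i ≡ᵇ x
... | true  = cong suc (count-↭ i p)
... | false = count-↭ i p
count-↭ i (↭.swap x y p) with i ≡ᵇ x | i ≡ᵇ y
... | true  | true  = cong (λ c → suc (suc c)) (count-↭ i p)
... | true  | false = cong suc (count-↭ i p)
... | false | true  = cong suc (count-↭ i p)
... | false | false = count-↭ i p
count-↭ i (↭.trans p q) = trans (count-↭ i p) (count-↭ i q)

allOnce-↭ : ∀ m {xs ys} → xs ↭ ys → allOnce m xs ≡ allOnce m ys
allOnce-↭ zero    p = refl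
allOnce-↭ (suc m) p = cong₂ (λ c b → (c ≡ᵇ 1) ∧ b) (count-↭ (suc m) p) (allOnce-↭ m p)

isPartition-↭ : ∀ n {xs ys} → xs ↭ ys → isPartition n xs ≡ isPartition n ys
isPartition-↭ n p = cong₂ (λ l b → (l ≡ᵇ n) ∧ b) (↭-length p) (allOnce-↭ n p)

allOnce-above : ∀ m x L → m < x → allOnce m (x ∷ L) ≡ allOnce m L
allOnce-above zero    x L m<x = refl
allOnce-above (suc m) x L m<x
  rewrite ≡ᵇ-≢ (<⇒≢ m<x) | allOnce-above m x L (<-trans (n<1+n m) m<x) = refl

count-above : ∀ x L → All (_< x) L → count x L ≡ 0
count-above x []      []         = refl
count-above x (y ∷ L) (y<x ∷ ys) rewrite ≡ᵇ-≢ (<⇒≢ y<x ∘ sym) = count-above x L ys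

count-∈ : ∀ x L → count x L ≡ 1 → x ∈ L
count-∈ x (y ∷ L) c with x ≡ᵇ y in e
... | true  = here (≡ᵇ-sound e)
... | false = there (count-∈ x L c)

isPartition-cons-unfold : ∀ n L →
  isPartition (suc n) (suc n ∷ L) ≡ (length L ≡ᵇ n) ∧ ((count (suc n) L ≡ᵇ 0) ∧ allOnce n L)
isPartition-cons-unfold n L rewrite ≡ᵇ-refl n | allOnce-above n (suc n) L (n<1+n n) = refl

isPartition-cons⇒ : ∀ n L → isPartition (suc n) (suc n ∷ L) ≡ true → isPartition n L ≡ true
isPartition-cons⇒ n L e rewrite isPartition-cons-unfold n L =
  ∧-intro (∧-elimˡ e) (∧-elimʳ {count (suc n) L ≡ᵇ 0} (∧-elimʳ {length L ≡ᵇ n} e))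

isPartition-unpeel : ∀ n L → isPartition (suc n) L ≡ true →
                     ∃ λ L′ → L ↭ suc n ∷ L′ × isPartition n L′ ≡ true
isPartition-unpeel n L e with ∈-∃++ (count-∈ (suc n) L (≡ᵇ-sound (∧-elimˡ (∧-elimʳ {length L ≡ᵇ suc n} e))))
... | ys , zs , refl = ys ++ zs , perm , isPartition-cons⇒ n (ys ++ zs) (trans (sym (isPartition-↭ (suc n) perm)) e)
  where
  perm : ys ++ [ suc n ] ++ zs ↭ suc n ∷ ys ++ zs
  perm = shift (suc n) ys zs

isPartition-bounded : ∀ n L → isPartition n L ≡ true → All (_≤ n) L
isPartition-bounded zero    []      _ = []
isPartition-bounded zero    (x ∷ L) ()
isPartition-bounded (suc n) L e with isPartition-unpeel n L e
... | L′ , L↭ , e′ = All-resp-↭ (↭-sym L↭) (≤-refl ∷ All.map m≤n⇒m≤1+n (isPartition-bounded n L′ e′))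

isPartition-cons : ∀ n L → isPartition (suc n) (suc n ∷ L) ≡ isPartition n L
isPartition-cons n L = bool-ext (isPartition-cons⇒ n L) cons⇐
  where
  cons⇐ : isPartition n L ≡ true → isPartition (suc n) (suc n ∷ L) ≡ true
  cons⇐ e rewrite isPartition-cons-unfold n L
                | count-above (suc n) L (All.map s≤s (isPartition-bounded n L e)) = e

isPartition-insert : ∀ n {L′ L} → L′ ↭ suc n ∷ L → isPartition (suc n) L′ ≡ isPartition n L
isPartition-insert n {L = L} p = trans (isPartition-↭ (suc n) p) (isPartition-cons n L)

isPartition-max : ∀ n L → isPartition (suc n) L ≡ true → suc n ∈ L
isPartition-max n L e with isPartition-unpeel n L e
... | _ , L↭ , _ = ∈-resp-↭ (↭-sym L↭) (here refl)

isPartition-length : ∀ n L → isPartition n L ≡ true → length L ≡ n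
isPartition-length n L e = ≡ᵇ-sound (∧-elimˡ e)

fresh-label : ∀ {X : Set} (labels : X → List ℕ) {N x y M} →
              All (_< N) (labels x) → x ≡ y → labels y ↭ N ∷ M → ⊥
fresh-label labels below refl p = <-irrefl refl (All.lookup below (∈-resp-↭ (↭-sym p) (here refl)))

-- An insertion structure: labelled objects with gaps, into each of which a
-- new leaf with a given label N can be inserted.  The fields are the facts
-- which make insertion of a label N above all present labels a bijection
-- onto the increasing objects whose largest label is N.
record InsertionStructure (gaps : ℕ → ℕ) : Set₁ where
  field
    Carrier : Set
    labels  : Carrier → List ℕ
    incr    : Carrier → Bool
    Gap     : Carrier → Set
    insert  : ℕ → (x : Carrier) → Gap x → Carrier
    labels-insert : ∀ N x g → labels (insert N x g) ↭ N ∷ labels x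
    incr-insert : ∀ N x g → All (_< N) (labels x) → incr (insert N x g) ≡ incr x
    insert-injective : ∀ N {x y} (g : Gap x) (h : Gap y) →
                       All (_< N) (labels x) → All (_< N) (labels y) →
                       insert N x g ≡ insert N y h → _≡_ {A = Σ Carrier Gap} (x , g) (y , h)
    -- in an increasing structure the maximal label N sits at a leaf
    insert-surjective : ∀ N y → incr y ≡ true → All (_≤ N) (labels y) → N ∈ labels y →
                        Σ Carrier λ x → Σ (Gap x) λ g → insert N x g ≡ y
    gap-count : ∀ x → Gap x ↔ Fin (gaps (length (labels x)))

module Counting {gaps : ℕ → ℕ} (S : InsertionStructure gaps) where
  open InsertionStructure S

  Valid : ℕ → Set
  Valid n = Σ Carrier λ x → (incr x ∧ isPartition n (labels x)) ≡ true

  valid-≡ : ∀ {n x y} {v : (incr x ∧ isPartition n (labels x)) ≡ true}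
              {w : (incr y ∧ isPartition n (labels y)) ≡ true} → x ≡ y → _≡_ {A = Valid n} (x , v) (y , w)
  valid-≡ {v = v} {w} refl = cong (_ ,_) (true-irrelevant v w)

  valid-bounded : ∀ n x → (incr x ∧ isPartition n (labels x)) ≡ true → All (_< suc n) (labels x)
  valid-bounded n x v = All.map s≤s (isPartition-bounded n (labels x) (∧-elimʳ {incr x} v))

  valid-insert : ∀ n x g → All (_< suc n) (labels x) →
                 (incr (insert (suc n) x g) ∧ isPartition (suc n) (labels (insert (suc n) x g)))
                   ≡ (incr x ∧ isPartition n (labels x))
  valid-insert n x g below =
    cong₂ _∧_ (incr-insert (suc n) x g below) (isPartition-insert n (labels-insert (suc n) x g))

  insertion : ∀ n → Σ (Valid n) (Gap ∘ proj₁) → Valid (suc n)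
  insertion n ((x , v) , g) = insert (suc n) x g , trans (valid-insert n x g (valid-bounded n x v)) v

  insertion-injective : ∀ n {z w} → insertion n z ≡ insertion n w → z ≡ w
  insertion-injective n {(x , v) , g} {(y , w) , h} eq
    with insert-injective (suc n) g h (valid-bounded n x v) (valid-bounded n y w) (cong proj₁ eq)
  ... | refl with true-irrelevant v w
  ... | refl = refl

  insertion-surjective : ∀ n (y : Valid (suc n)) → Σ (Σ (Valid n) (Gap ∘ proj₁)) λ z → insertion n z ≡ y
  insertion-surjective n (y , v)
    with insert-surjective (suc n) y (∧-elimˡ v) (isPartition-bounded (suc n) (labels y) (∧-elimʳ {incr y} v))
                                                 (isPartition-max n (labels y) (∧-elimʳ {incr y} v))
  ... | x , g , refl = ((x , v′) , g) , valid-≡ refl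
    where
    x-partition : isPartition n (labels x) ≡ true
    x-partition = trans (sym (isPartition-insert n (labels-insert (suc n) x g))) (∧-elimʳ {incr (insert (suc n) x g)} v)
    v′ : (incr x ∧ isPartition n (labels x)) ≡ true
    v′ = trans (sym (valid-insert n x g (All.map s≤s (isPartition-bounded n (labels x) x-partition)))) v

  insertion-↔ : ∀ n → Σ (Valid n) (Gap ∘ proj₁) ↔ Valid (suc n)
  insertion-↔ n = mk↔ₛ′ (insertion n) (proj₁ ∘ preimage) (proj₂ ∘ preimage)
                        (λ z → insertion-injective n (proj₂ (preimage (insertion n z))))
    where
    preimage : ∀ y → Σ (Σ (Valid n) (Gap ∘ proj₁)) λ z → insertion n z ≡ y
    preimage = insertion-surjective n

  valid-step : ∀ n → Valid (suc n) ↔ (Valid n × Fin (gaps n))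
  valid-step n = ↔-trans (↔-sym (insertion-↔ n)) (Σ-↔ {B = λ _ → Fin (gaps n)} ↔-refl (λ {v} → gaps-of-valid {v}))
    where
    gaps-of-valid : ∀ {v : Valid n} → Gap (proj₁ v) ↔ Fin (gaps n)
    gaps-of-valid {x , v} = subst (λ m → Gap x ↔ Fin (gaps m))
                                  (isPartition-length n (labels x) (∧-elimʳ {incr x} v)) (gap-count x)

  valid-zero : (x₀ : Carrier) → incr x₀ ≡ true → labels x₀ ≡ [] →
               (∀ x → length (labels x) ≡ 0 → x ≡ x₀) → Valid 0 ↔ ⊤
  valid-zero x₀ incr₀ labels₀ unique =
    mk↔ₛ′ (λ _ → tt) (λ _ → x₀ , v₀) (λ _ → refl)
          (λ { (x , v) → valid-≡ (sym (unique x (isPartition-length 0 (labels x) (∧-elimʳ {incr x} v)))) })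
    where
    v₀ : (incr x₀ ∧ isPartition 0 (labels x₀)) ≡ true
    v₀ rewrite incr₀ | labels₀ = refl

valid-↔ : ∀ {gaps} (S T : InsertionStructure gaps) →
          Counting.Valid S 0 ↔ Counting.Valid T 0 → ∀ n → Counting.Valid S n ↔ Counting.Valid T n
valid-↔ S T base zero    = base
valid-↔ S T base (suc n) =
  ↔-trans (Counting.valid-step S n) (↔-trans (valid-↔ S T base n ×-↔ ↔-refl) (↔-sym (Counting.valid-step T n)))

⊎-Fin : ∀ {A B : Set} {m n} → A ↔ Fin m → B ↔ Fin n → (A ⊎ B) ↔ Fin (m + n)
⊎-Fin A↔ B↔ = ↔-trans (A↔ ⊎-↔ B↔) (↔-sym +↔⊎)

gaps-append : ∀ d j a b → suc (d * a) + (j + d * b) ≡ suc j + d * (a + b)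
gaps-append = solve-∀

gaps-tree-forest : ∀ k V F → (k + suc k * V) + suc (suc k * F) ≡ suc k * suc (V + F)
gaps-tree-forest = solve-∀

-- Sequences of k-bundled trees.  A gap of a forest (an ordered list of
-- trees: a bundle, or the top-level sequence) is its front, or a gap inside
-- its first tree, or a gap of the remaining forest; inserting the label N
-- into the front gap puts the leaf N there.
module BundledForests (k : ℕ) where

  Forest : Set
  Forest = List (BTree k)

  bundles : BTree k → Vec Forest k
  bundles (node _ bs) = bs

  noBundles : ∀ j → Vec Forest j
  noBundles j = replicate j []

  leaf : ℕ → BTree k
  leaf N = node N (noBundles k)

  labels-noBundles : ∀ j → labelsV (noBundles j) ≡ []
  labels-noBundles zero    = refl
  labels-noBundles (suc j) = labels-noBundles j

  incr-noBundles : ∀ x j → incrV x (noBundles j) ≡ true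
  incr-noBundles x zero    = refl
  incr-noBundles x (suc j) = incr-noBundles x j

  mutual
    GapF : Forest → Set
    GapF ts = ⊤ ⊎ GapAfter ts

    GapAfter : Forest → Set
    GapAfter []       = ⊥
    GapAfter (t ∷ ts) = GapT t ⊎ GapF ts

    GapT : BTree k → Set
    GapT (node _ bs) = GapV bs

    GapV : ∀ {j} → Vec Forest j → Set
    GapV []        = ⊥
    GapV (ts ∷ bs) = GapF ts ⊎ GapV bs

  mutual
    gapsF : Forest → ℕ
    gapsF ts = suc (gapsAfter ts)

    gapsAfter : Forest → ℕ
    gapsAfter []       = 0
    gapsAfter (t ∷ ts) = gapsT t + gapsF ts

    gapsT : BTree k → ℕ
    gapsT (node _ bs) = gapsV bs

    gapsV : ∀ {j} → Vec Forest j → ℕ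
    gapsV []        = 0
    gapsV (ts ∷ bs) = gapsF ts + gapsV bs

  mutual
    gapF-↔ : ∀ ts → GapF ts ↔ Fin (gapsF ts)
    gapF-↔ ts = ⊎-Fin (↔-sym 1↔⊤) (gapAfter-↔ ts)

    gapAfter-↔ : ∀ ts → GapAfter ts ↔ Fin (gapsAfter ts)
    gapAfter-↔ []       = ↔-sym 0↔⊥
    gapAfter-↔ (t ∷ ts) = ⊎-Fin (gapT-↔ t) (gapF-↔ ts)

    gapT-↔ : ∀ t → GapT t ↔ Fin (gapsT t)
    gapT-↔ (node _ bs) = gapV-↔ bs

    gapV-↔ : ∀ {j} (bs : Vec Forest j) → GapV bs ↔ Fin (gapsV bs)
    gapV-↔ []        = ↔-sym 0↔⊥
    gapV-↔ (ts ∷ bs) = ⊎-Fin (gapF-↔ ts) (gapV-↔ bs)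

  -- every label adds k + 1 gaps: its k empty bundles and the gap after it
  mutual
    gapsAfter-count : ∀ ts → gapsAfter ts ≡ suc k * length (labelsL ts)
    gapsAfter-count [] = sym (*-zeroʳ (suc k))
    gapsAfter-count (node x bs ∷ ts) = begin
      gapsV bs + suc (gapsAfter ts)
        ≡⟨ cong₂ (λ a b → a + suc b) (gapsV-count bs) (gapsAfter-count ts) ⟩
      (k + suc k * V) + suc (suc k * F)
        ≡⟨ gaps-tree-forest k V F ⟩
      suc k * suc (V + F)
        ≡⟨ cong (λ l → suc k * suc l) (sym (length-++ (labelsV bs))) ⟩
      suc k * suc (length (labelsV bs ++ labelsL ts)) ∎
      where
      open ≡-Reasoning
      V F : ℕ
      V = length (labelsV bs)
      F = length (labelsL ts)

    gapsV-count : ∀ {j} (bs : Vec Forest j) → gapsV bs ≡ j + suc k * length (labelsV bs)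
    gapsV-count [] = sym (*-zeroʳ (suc k))
    gapsV-count {suc j} (ts ∷ bs) = begin
      suc (gapsAfter ts) + gapsV bs
        ≡⟨ cong₂ (λ a b → suc a + b) (gapsAfter-count ts) (gapsV-count bs) ⟩
      suc (suc k * F) + (j + suc k * V)
        ≡⟨ gaps-append (suc k) j F V ⟩
      suc j + suc k * (F + V)
        ≡⟨ cong (λ l → suc j + suc k * l) (sym (length-++ (labelsL ts))) ⟩
      suc j + suc k * length (labelsL ts ++ labelsV bs) ∎
      where
      open ≡-Reasoning
      V F : ℕ
      V = length (labelsV bs)
      F = length (labelsL ts)

  gap-count : ∀ ts → GapF ts ↔ Fin (suc (suc k * length (labelsL ts)))
  gap-count ts = subst (λ m → GapF ts ↔ Fin (suc m)) (gapsAfter-count ts) (gapF-↔ ts)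

  incrL⇒allIncrB : ∀ x ts → incrL {k} x ts ≡ true → allIncrB ts ≡ true
  incrL⇒allIncrB x []       _   = refl
  incrL⇒allIncrB x (t ∷ ts) inc =
    ∧-intro (∧-elimˡ (∧-elimʳ {x <ᵇ rootB t} inc)) (incrL⇒allIncrB x ts (∧-elimʳ (∧-elimʳ {x <ᵇ rootB t} inc)))

  module Insert (N : ℕ) where

    mutual
      insF : (ts : Forest) → GapF ts → Forest
      insF ts       (inj₁ _)        = leaf N ∷ ts
      insF (t ∷ ts) (inj₂ (inj₁ g)) = insT t g ∷ ts
      insF (t ∷ ts) (inj₂ (inj₂ g)) = t ∷ insF ts g

      insT : (t : BTree k) → GapT t → BTree k
      insT (node x bs) g = node x (insV bs g)

      insV : ∀ {j} (bs : Vec Forest j) → GapV bs → Vec Forest j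
      insV (ts ∷ bs) (inj₁ g) = insF ts g ∷ bs
      insV (ts ∷ bs) (inj₂ g) = ts ∷ insV bs g

    mutual
      labels-insF : ∀ ts g → labelsL (insF ts g) ↭ N ∷ labelsL ts
      labels-insF ts       (inj₁ _) rewrite labels-noBundles k = ↭.refl
      labels-insF (t ∷ ts) (inj₂ (inj₁ g)) = ++⁺ʳ (labelsL ts) (labels-insT t g)
      labels-insF (t ∷ ts) (inj₂ (inj₂ g)) =
        ↭.trans (++⁺ˡ (labelsB t) (labels-insF ts g)) (shift N (labelsB t) (labelsL ts))

      labels-insT : ∀ t g → labelsB (insT t g) ↭ N ∷ labelsB t
      labels-insT (node x bs) g = ↭.trans (↭.prep x (labels-insV bs g)) (↭.swap x N ↭.refl)

      labels-insV : ∀ {j} (bs : Vec Forest j) g → labelsV (insV bs g) ↭ N ∷ labelsV bs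
      labels-insV (ts ∷ bs) (inj₁ g) = ++⁺ʳ (labelsV bs) (labels-insF ts g)
      labels-insV (ts ∷ bs) (inj₂ g) =
        ↭.trans (++⁺ˡ (labelsL ts) (labels-insV bs g)) (shift N (labelsL ts) (labelsV bs))

    mutual
      incr-insT : ∀ t g → All (_< N) (labelsB t) → incrB (insT t g) ≡ incrB t
      incr-insT (node x bs) g (x<N ∷ below) = incr-insV x bs g x<N below

      incr-insL : ∀ x ts g → x < N → All (_< N) (labelsL ts) → incrL x (insF ts g) ≡ incrL x ts
      incr-insL x ts (inj₁ _) x<N _ rewrite <ᵇ-complete x<N | incr-noBundles N k = refl
      incr-insL x (node y bs ∷ ts) (inj₂ (inj₁ g)) _ below
        rewrite incr-insT (node y bs) g (++⁻ˡ (labelsB (node y bs)) below) = refl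
      incr-insL x (t ∷ ts) (inj₂ (inj₂ g)) x<N below
        rewrite incr-insL x ts g x<N (++⁻ʳ (labelsB t) below) = refl

      incr-insV : ∀ x {j} (bs : Vec Forest j) g → x < N → All (_< N) (labelsV bs) →
                  incrV x (insV bs g) ≡ incrV x bs
      incr-insV x (ts ∷ bs) (inj₁ g) x<N below
        rewrite incr-insL x ts g x<N (++⁻ˡ (labelsL ts) below) = refl
      incr-insV x (ts ∷ bs) (inj₂ g) x<N below
        rewrite incr-insV x bs g x<N (++⁻ʳ (labelsL ts) below) = refl

    allIncr-insF : ∀ ts g → All (_< N) (labelsL ts) → allIncrB (insF ts g) ≡ allIncrB ts
    allIncr-insF ts (inj₁ _) _ rewrite incr-noBundles N k = refl
    allIncr-insF (t ∷ ts) (inj₂ (inj₁ g)) below rewrite incr-insT t g (++⁻ˡ (labelsB t) below) = refl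
    allIncr-insF (t ∷ ts) (inj₂ (inj₂ g)) below rewrite allIncr-insF ts g (++⁻ʳ (labelsB t) below) = refl

    leaf-shape : ∀ {j} (bs : Vec Forest j) → incrV N bs ≡ true → All (_≤ N) (labelsV bs) → bs ≡ noBundles j
    leaf-shape []        _   _     = refl
    leaf-shape ([] ∷ bs) inc bound = cong ([] ∷_) (leaf-shape bs inc bound)
    leaf-shape ((node y _ ∷ _) ∷ _) inc (y≤N ∷ _) =
      ⊥-elim (<-irrefl refl (<-≤-trans (<ᵇ-sound (∧-elimˡ (∧-elimˡ inc))) y≤N))

    mutual
      insF-surjective : ∀ ts → allIncrB ts ≡ true → All (_≤ N) (labelsL ts) → N ∈ labelsL ts →
                        Σ Forest λ ss → Σ (GapF ss) λ g → insF ss g ≡ ts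
      insF-surjective (t ∷ ts) inc bound N∈ with ∈-++⁻ (labelsB t) N∈
      ... | inj₂ N∈ts with insF-surjective ts (∧-elimʳ {incrB t} inc) (++⁻ʳ (labelsB t) bound) N∈ts
      ...   | ss , g , refl = t ∷ ss , inj₂ (inj₂ g) , refl
      insF-surjective (t ∷ ts) inc bound N∈ | inj₁ N∈t
        with insT-surjective t (∧-elimˡ inc) (++⁻ˡ (labelsB t) bound) N∈t
      ...   | inj₁ refl             = ts , inj₁ tt , refl
      ...   | inj₂ (s , g , refl)   = s ∷ ts , inj₂ (inj₁ g) , refl

      insT-surjective : ∀ t → incrB t ≡ true → All (_≤ N) (labelsB t) → N ∈ labelsB t →
                        t ≡ leaf N ⊎ Σ (BTree k) λ s → Σ (GapT s) λ g → insT s g ≡ t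
      insT-surjective (node x bs) inc (_ ∷ bound) (here refl) = inj₁ (cong (node N) (leaf-shape bs inc bound))
      insT-surjective (node x bs) inc (_ ∷ bound) (there N∈) with insV-surjective x bs inc bound N∈
      ... | cs , g , refl = inj₂ (node x cs , g , refl)

      insV-surjective : ∀ {j} x (bs : Vec Forest j) → incrV x bs ≡ true → All (_≤ N) (labelsV bs) →
                        N ∈ labelsV bs → Σ (Vec Forest j) λ cs → Σ (GapV cs) λ g → insV cs g ≡ bs
      insV-surjective x (ts ∷ bs) inc bound N∈ with ∈-++⁻ (labelsL ts) N∈
      ... | inj₁ N∈ts with insF-surjective ts (incrL⇒allIncrB x ts (∧-elimˡ inc)) (++⁻ˡ (labelsL ts) bound) N∈ts
      ...   | ss , g , refl = ss ∷ bs , inj₁ g , refl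
      insV-surjective x (ts ∷ bs) inc bound N∈ | inj₂ N∈bs
        with insV-surjective x bs (∧-elimʳ {incrL x ts} inc) (++⁻ʳ (labelsL ts) bound) N∈bs
      ...   | cs , g , refl = ts ∷ cs , inj₂ g , refl

    -- inserting into a gap after the front keeps an old tree in front,
    -- whose root is below N
    leaf-not-first : ∀ {ss} ts (g : GapAfter ts) → All (_< N) (labelsL ts) →
                     leaf N ∷ ss ≡ insF ts (inj₂ g) → ⊥
    leaf-not-first (node x _ ∷ _) (inj₁ _) (x<N ∷ _) eq = <-irrefl (sym (cong rootB (∷-injectiveˡ eq))) x<N
    leaf-not-first (node x _ ∷ _) (inj₂ _) (x<N ∷ _) eq = <-irrefl (sym (cong rootB (∷-injectiveˡ eq))) x<N

    mutual
      insF-injective : ∀ {ss ts} (g : GapF ss) (h : GapF ts) → All (_< N) (labelsL ss) → All (_< N) (labelsL ts) →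
                       insF ss g ≡ insF ts h → _≡_ {A = Σ Forest GapF} (ss , g) (ts , h)
      insF-injective (inj₁ _) (inj₁ _) _ _ eq with ∷-injectiveʳ eq
      ... | refl = refl
      insF-injective (inj₁ _) (inj₂ h) _   new eq = ⊥-elim (leaf-not-first _ h new eq)
      insF-injective (inj₂ g) (inj₁ _) old _   eq = ⊥-elim (leaf-not-first _ g old (sym eq))
      insF-injective {s ∷ ss} {t ∷ ts} (inj₂ (inj₁ g)) (inj₂ (inj₁ h)) old new eq
        with insT-injective g h (++⁻ˡ (labelsB s) old) (++⁻ˡ (labelsB t) new) (∷-injectiveˡ eq) | ∷-injectiveʳ eq
      ... | refl | refl = refl
      insF-injective {s ∷ ss} {t ∷ ts} (inj₂ (inj₂ g)) (inj₂ (inj₂ h)) old new eq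
        with ∷-injectiveˡ eq | insF-injective g h (++⁻ʳ (labelsB s) old) (++⁻ʳ (labelsB t) new) (∷-injectiveʳ eq)
      ... | refl | refl = refl
      insF-injective {s ∷ ss} {t ∷ ts} (inj₂ (inj₁ _)) (inj₂ (inj₂ h)) old _ eq =
        ⊥-elim (fresh-label labelsL (++⁻ʳ (labelsB s) old) (∷-injectiveʳ eq) (labels-insF ts h))
      insF-injective {s ∷ ss} {t ∷ ts} (inj₂ (inj₂ g)) (inj₂ (inj₁ _)) _ new eq =
        ⊥-elim (fresh-label labelsL (++⁻ʳ (labelsB t) new) (sym (∷-injectiveʳ eq)) (labels-insF ss g))

      insT-injective : ∀ {s t} (g : GapT s) (h : GapT t) → All (_< N) (labelsB s) → All (_< N) (labelsB t) →
                       insT s g ≡ insT t h → _≡_ {A = Σ (BTree k) GapT} (s , g) (t , h)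
      insT-injective {node _ bs} {node _ cs} g h (_ ∷ old) (_ ∷ new) eq
        with cong rootB eq | insV-injective g h old new (cong bundles eq)
      ... | refl | refl = refl

      insV-injective : ∀ {j} {bs cs : Vec Forest j} (g : GapV bs) (h : GapV cs) →
                       All (_< N) (labelsV bs) → All (_< N) (labelsV cs) →
                       insV bs g ≡ insV cs h → _≡_ {A = Σ (Vec Forest j) GapV} (bs , g) (cs , h)
      insV-injective {bs = ss ∷ bs} {ts ∷ cs} (inj₁ g) (inj₁ h) old new eq
        with insF-injective g h (++⁻ˡ (labelsL ss) old) (++⁻ˡ (labelsL ts) new) (Vec.∷-injectiveˡ eq)
           | Vec.∷-injectiveʳ eq
      ... | refl | refl = refl
      insV-injective {bs = ss ∷ bs} {ts ∷ cs} (inj₂ g) (inj₂ h) old new eq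
        with Vec.∷-injectiveˡ eq | insV-injective g h (++⁻ʳ (labelsL ss) old) (++⁻ʳ (labelsL ts) new) (Vec.∷-injectiveʳ eq)
      ... | refl | refl = refl
      insV-injective {bs = ss ∷ bs} {ts ∷ cs} (inj₁ _) (inj₂ h) old _ eq =
        ⊥-elim (fresh-label labelsV (++⁻ʳ (labelsL ss) old) (Vec.∷-injectiveʳ eq) (labels-insV cs h))
      insV-injective {bs = ss ∷ bs} {ts ∷ cs} (inj₂ g) (inj₁ _) _ new eq =
        ⊥-elim (fresh-label labelsV (++⁻ʳ (labelsL ts) new) (sym (Vec.∷-injectiveʳ eq)) (labels-insV bs g))

  forests : InsertionStructure (λ L → suc (suc k * L))
  forests = record
    { Carrier           = Forest
    ; labels            = labelsL
    ; incr              = allIncrB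
    ; Gap               = GapF
    ; insert            = Insert.insF
    ; labels-insert     = Insert.labels-insF
    ; incr-insert       = Insert.allIncr-insF
    ; insert-injective  = λ N g h → Insert.insF-injective N g h
    ; insert-surjective = Insert.insF-surjective
    ; gap-count         = gap-count
    }

  forests-zero : Counting.Valid forests 0 ↔ ⊤
  forests-zero = Counting.valid-zero forests [] refl refl empty-only
    where
    empty-only : ∀ ts → length (labelsL ts) ≡ 0 → ts ≡ []
    empty-only []                _  = refl
    empty-only (node _ _ ∷ _) ()

-- Increasing (d+1)-ary trees, extended by the empty tree: a position is
-- either empty or holds a tree.  Allowing the empty tree makes the base
-- case (no labels) the same as for sequences of bundled trees.
module PositionTrees (d : ℕ) where

  Tree : Set
  Tree = ATree (suc d)

  Position : Set
  Position = Maybe Tree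

  children : Tree → Vec Position (suc d)
  children (node _ cs) = cs

  noChildren : ∀ j → Vec Position j
  noChildren j = replicate j nothing

  leaf : ℕ → Tree
  leaf N = node N (noChildren (suc d))

  labels-noChildren : ∀ j → labelsAV (noChildren j) ≡ []
  labels-noChildren zero    = refl
  labels-noChildren (suc j) = labels-noChildren j

  incr-noChildren : ∀ x j → incrAV x (noChildren j) ≡ true
  incr-noChildren x zero    = refl
  incr-noChildren x (suc j) = incr-noChildren x j

  labelsP : Position → List ℕ
  labelsP nothing  = []
  labelsP (just t) = labelsA t

  incrP : Position → Bool
  incrP nothing  = true
  incrP (just t) = incrA t

  labelsAV-∷ : ∀ {j} p (ps : Vec Position j) → labelsAV (p ∷ ps) ≡ labelsP p ++ labelsAV ps
  labelsAV-∷ nothing  ps = refl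
  labelsAV-∷ (just t) ps = refl

  All-labelsAV-∷ : ∀ {P : ℕ → Set} {j} p (ps : Vec Position j) →
                   All P (labelsAV (p ∷ ps)) → All P (labelsP p) × All P (labelsAV ps)
  All-labelsAV-∷ {P} p ps = ++⁻ (labelsP p) ∘ subst (All P) (labelsAV-∷ p ps)

  mutual
    GapP : Position → Set
    GapP nothing  = ⊤
    GapP (just t) = GapT t

    GapT : Tree → Set
    GapT (node _ cs) = GapPs cs

    GapPs : ∀ {j} → Vec Position j → Set
    GapPs []       = ⊥
    GapPs (p ∷ ps) = GapP p ⊎ GapPs ps

  mutual
    gapsP : Position → ℕ
    gapsP nothing  = 1
    gapsP (just t) = gapsT t

    gapsT : Tree → ℕ
    gapsT (node _ cs) = gapsPs cs

    gapsPs : ∀ {j} → Vec Position j → ℕ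
    gapsPs []       = 0
    gapsPs (p ∷ ps) = gapsP p + gapsPs ps

  mutual
    gapP-↔ : ∀ p → GapP p ↔ Fin (gapsP p)
    gapP-↔ nothing  = ↔-sym 1↔⊤
    gapP-↔ (just t) = gapT-↔ t

    gapT-↔ : ∀ t → GapT t ↔ Fin (gapsT t)
    gapT-↔ (node _ cs) = gapPs-↔ cs

    gapPs-↔ : ∀ {j} (ps : Vec Position j) → GapPs ps ↔ Fin (gapsPs ps)
    gapPs-↔ []       = ↔-sym 0↔⊥
    gapPs-↔ (p ∷ ps) = ⊎-Fin (gapP-↔ p) (gapPs-↔ ps)

  -- every label fills one position and brings d + 1 empty ones
  mutual
    gapsP-count : ∀ p → gapsP p ≡ suc (d * length (labelsP p))
    gapsP-count nothing = cong suc (sym (*-zeroʳ d))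
    gapsP-count (just (node _ cs)) =
      trans (gapsPs-count cs) (cong suc (sym (*-suc d (length (labelsAV cs)))))

    gapsPs-count : ∀ {j} (ps : Vec Position j) → gapsPs ps ≡ j + d * length (labelsAV ps)
    gapsPs-count [] = sym (*-zeroʳ d)
    gapsPs-count {suc j} (p ∷ ps) = begin
      gapsP p + gapsPs ps
        ≡⟨ cong₂ _+_ (gapsP-count p) (gapsPs-count ps) ⟩
      suc (d * P) + (j + d * Q)
        ≡⟨ gaps-append d j P Q ⟩
      suc j + d * (P + Q)
        ≡⟨ cong (λ l → suc j + d * l) (sym (length-++ (labelsP p))) ⟩
      suc j + d * length (labelsP p ++ labelsAV ps)
        ≡⟨ cong (λ L → suc j + d * length L) (sym (labelsAV-∷ p ps)) ⟩
      suc j + d * length (labelsAV (p ∷ ps)) ∎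
      where
      open ≡-Reasoning
      P Q : ℕ
      P = length (labelsP p)
      Q = length (labelsAV ps)

  gap-count : ∀ p → GapP p ↔ Fin (suc (d * length (labelsP p)))
  gap-count p = subst (λ m → GapP p ↔ Fin m) (gapsP-count p) (gapP-↔ p)

  module Insert (N : ℕ) where

    mutual
      insP : (p : Position) → GapP p → Position
      insP nothing  _ = just (leaf N)
      insP (just t) g = just (insT t g)

      insT : (t : Tree) → GapT t → Tree
      insT (node x cs) g = node x (insPs cs g)

      insPs : ∀ {j} (ps : Vec Position j) → GapPs ps → Vec Position j
      insPs (p ∷ ps) (inj₁ g) = insP p g ∷ ps
      insPs (p ∷ ps) (inj₂ g) = p ∷ insPs ps g

    mutual
      labels-insP : ∀ p g → labelsP (insP p g) ↭ N ∷ labelsP p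
      labels-insP nothing  _ rewrite labels-noChildren (suc d) = ↭.refl
      labels-insP (just t) g = labels-insT t g

      labels-insT : ∀ t g → labelsA (insT t g) ↭ N ∷ labelsA t
      labels-insT (node x cs) g = ↭.trans (↭.prep x (labels-insPs cs g)) (↭.swap x N ↭.refl)

      labels-insPs : ∀ {j} (ps : Vec Position j) g → labelsAV (insPs ps g) ↭ N ∷ labelsAV ps
      labels-insPs (p ∷ ps) (inj₁ g) rewrite labelsAV-∷ (insP p g) ps | labelsAV-∷ p ps =
        ++⁺ʳ (labelsAV ps) (labels-insP p g)
      labels-insPs (p ∷ ps) (inj₂ g) rewrite labelsAV-∷ p (insPs ps g) | labelsAV-∷ p ps =
        ↭.trans (++⁺ˡ (labelsP p) (labels-insPs ps g)) (shift N (labelsP p) (labelsAV ps))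

    mutual
      incr-insT : ∀ t g → All (_< N) (labelsA t) → incrA (insT t g) ≡ incrA t
      incr-insT (node x cs) g (x<N ∷ below) = incr-insPs x cs g x<N below

      incr-insPs : ∀ x {j} (ps : Vec Position j) g → x < N → All (_< N) (labelsAV ps) →
                   incrAV x (insPs ps g) ≡ incrAV x ps
      incr-insPs x (nothing ∷ ps) (inj₁ _) x<N _
        rewrite <ᵇ-complete x<N | incr-noChildren N (suc d) = refl
      incr-insPs x (just (node y cs) ∷ ps) (inj₁ g) _ below
        rewrite incr-insT (node y cs) g (++⁻ˡ (labelsA (node y cs)) below) = refl
      incr-insPs x (nothing ∷ ps) (inj₂ g) x<N below = incr-insPs x ps g x<N below
      incr-insPs x (just t ∷ ps) (inj₂ g) x<N below
        rewrite incr-insPs x ps g x<N (++⁻ʳ (labelsA t) below) = refl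

    incr-insP : ∀ p g → All (_< N) (labelsP p) → incrP (insP p g) ≡ incrP p
    incr-insP nothing  _ _     = incr-noChildren N (suc d)
    incr-insP (just t) g below = incr-insT t g below

    leaf-shape : ∀ {j} (ps : Vec Position j) → incrAV N ps ≡ true → All (_≤ N) (labelsAV ps) → ps ≡ noChildren j
    leaf-shape []             _   _     = refl
    leaf-shape (nothing ∷ ps) inc bound = cong (nothing ∷_) (leaf-shape ps inc bound)
    leaf-shape (just (node y _) ∷ _) inc (y≤N ∷ _) =
      ⊥-elim (<-irrefl refl (<-≤-trans (<ᵇ-sound (∧-elimˡ inc)) y≤N))

    mutual
      insT-surjective : ∀ t → incrA t ≡ true → All (_≤ N) (labelsA t) → N ∈ labelsA t →
                        Σ Position λ q → Σ (GapP q) λ g → insP q g ≡ just t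
      insT-surjective (node x cs) inc (_ ∷ bound) (here refl) =
        nothing , tt , cong (λ qs → just (node N qs)) (sym (leaf-shape cs inc bound))
      insT-surjective (node x cs) inc (_ ∷ bound) (there N∈) with insPs-surjective x cs inc bound N∈
      ... | qs , g , refl = just (node x qs) , g , refl

      insPs-surjective : ∀ {j} x (ps : Vec Position j) → incrAV x ps ≡ true → All (_≤ N) (labelsAV ps) →
                         N ∈ labelsAV ps → Σ (Vec Position j) λ qs → Σ (GapPs qs) λ g → insPs qs g ≡ ps
      insPs-surjective x (nothing ∷ ps) inc bound N∈ with insPs-surjective x ps inc bound N∈
      ... | qs , g , refl = nothing ∷ qs , inj₂ g , refl
      insPs-surjective x (just t ∷ ps) inc bound N∈ with ∈-++⁻ (labelsA t) N∈
      ... | inj₁ N∈t with insT-surjective t (∧-elimˡ (∧-elimʳ {x <ᵇ rootA t} inc)) (++⁻ˡ (labelsA t) bound) N∈t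
      ...   | q , g , q↦t = q ∷ ps , inj₁ g , cong (_∷ ps) q↦t
      insPs-surjective x (just t ∷ ps) inc bound N∈ | inj₂ N∈ps
        with insPs-surjective x ps (∧-elimʳ (∧-elimʳ {x <ᵇ rootA t} inc)) (++⁻ʳ (labelsA t) bound) N∈ps
      ...   | qs , g , refl = just t ∷ qs , inj₂ g , refl

    insP-surjective : ∀ p → incrP p ≡ true → All (_≤ N) (labelsP p) → N ∈ labelsP p →
                      Σ Position λ q → Σ (GapP q) λ g → insP q g ≡ p
    insP-surjective nothing  _ _ ()
    insP-surjective (just t) = insT-surjective t

    leaf-not-inserted : ∀ t g → All (_< N) (labelsA t) → leaf N ≡ insT t g → ⊥
    leaf-not-inserted (node x _) _ (x<N ∷ _) eq = <-irrefl (sym (cong rootA eq)) x<N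

    mutual
      insP-injective : ∀ {p q} (g : GapP p) (h : GapP q) → All (_< N) (labelsP p) → All (_< N) (labelsP q) →
                       insP p g ≡ insP q h → _≡_ {A = Σ Position GapP} (p , g) (q , h)
      insP-injective {nothing} {nothing} _ _ _ _ _ = refl
      insP-injective {nothing} {just t} _ h _ new eq = ⊥-elim (leaf-not-inserted t h new (just-injective eq))
      insP-injective {just t} {nothing} g _ old _ eq = ⊥-elim (leaf-not-inserted t g old (sym (just-injective eq)))
      insP-injective {just t} {just u} g h old new eq with insT-injective g h old new (just-injective eq)
      ... | refl = refl

      insT-injective : ∀ {s t} (g : GapT s) (h : GapT t) → All (_< N) (labelsA s) → All (_< N) (labelsA t) →
                       insT s g ≡ insT t h → _≡_ {A = Σ Tree GapT} (s , g) (t , h)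
      insT-injective {node _ cs} {node _ ds} g h (_ ∷ old) (_ ∷ new) eq
        with cong rootA eq | insPs-injective g h old new (cong children eq)
      ... | refl | refl = refl

      insPs-injective : ∀ {j} {ps qs : Vec Position j} (g : GapPs ps) (h : GapPs qs) →
                        All (_< N) (labelsAV ps) → All (_< N) (labelsAV qs) →
                        insPs ps g ≡ insPs qs h → _≡_ {A = Σ (Vec Position j) GapPs} (ps , g) (qs , h)
      insPs-injective {ps = p ∷ ps} {q ∷ qs} (inj₁ g) (inj₁ h) old new eq
        with insP-injective g h (proj₁ (All-labelsAV-∷ p ps old)) (proj₁ (All-labelsAV-∷ q qs new)) (Vec.∷-injectiveˡ eq)
           | Vec.∷-injectiveʳ eq
      ... | refl | refl = refl
      insPs-injective {ps = p ∷ ps} {q ∷ qs} (inj₂ g) (inj₂ h) old new eq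
        with Vec.∷-injectiveˡ eq
           | insPs-injective g h (proj₂ (All-labelsAV-∷ p ps old)) (proj₂ (All-labelsAV-∷ q qs new)) (Vec.∷-injectiveʳ eq)
      ... | refl | refl = refl
      insPs-injective {ps = p ∷ ps} {q ∷ qs} (inj₁ _) (inj₂ h) old _ eq =
        ⊥-elim (fresh-label labelsAV (proj₂ (All-labelsAV-∷ p ps old)) (Vec.∷-injectiveʳ eq) (labels-insPs qs h))
      insPs-injective {ps = p ∷ ps} {q ∷ qs} (inj₂ g) (inj₁ _) _ new eq =
        ⊥-elim (fresh-label labelsAV (proj₂ (All-labelsAV-∷ q qs new)) (sym (Vec.∷-injectiveʳ eq)) (labels-insPs ps g))

  positions : InsertionStructure (λ L → suc (d * L))
  positions = record
    { Carrier           = Position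
    ; labels            = labelsP
    ; incr              = incrP
    ; Gap               = GapP
    ; insert            = Insert.insP
    ; labels-insert     = Insert.labels-insP
    ; incr-insert       = Insert.incr-insP
    ; insert-injective  = λ N g h → Insert.insP-injective N g h
    ; insert-surjective = Insert.insP-surjective
    ; gap-count         = gap-count
    }

  positions-zero : Counting.Valid positions 0 ↔ ⊤
  positions-zero = Counting.valid-zero positions nothing refl refl empty-only
    where
    empty-only : ∀ p → length (labelsP p) ≡ 0 → p ≡ nothing
    empty-only nothing           _  = refl
    empty-only (just (node _ _)) ()

  positions-trees : ∀ n → Counting.Valid positions (suc n) ↔ A (suc d) (suc n)
  positions-trees n = mk↔ₛ′ tree (λ { (t , v) → just t , v }) (λ _ → refl) from∘tree
    where
    tree : Counting.Valid positions (suc n) → A (suc d) (suc n)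
    tree (just t , v) = t , v
    tree (nothing , ())
    from∘tree : ∀ p → (just (proj₁ (tree p)) , proj₂ (tree p)) ≡ p
    from∘tree (just t , v) = refl
    from∘tree (nothing , ())

-- Sequences of k-bundled trees and positions of
-- (k+2)-ary trees are insertion structures with the same gap count
-- 1 + (k+1)·L and a single empty structure, hence equinumerous in every
-- size; for n ≥ 1 valid positions are exactly the (k+2)-ary increasing
-- trees.
theorem4p2 : (k n : ℕ) → 1 ≤ k → 1 ≤ n → SEQB k n ⤖ A (k + 2) n
theorem4p2 k zero    _ ()
theorem4p2 k (suc n) _ _ = ↔⇒⤖ (subst (λ m → SEQB k (suc n) ↔ A m (suc n)) (+-comm 2 k) sequences↔trees)
  where
  open BundledForests k using (forests; forests-zero)
  open PositionTrees (suc k) using (positions; positions-zero; positions-trees)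
  sequences↔trees : SEQB k (suc n) ↔ A (2 + k) (suc n)
  sequences↔trees = ↔-trans (valid-↔ forests positions (↔-trans forests-zero (↔-sym positions-zero)) (suc n))
                            (positions-trees n)
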